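{- For each integer $d\geq 1$, $\mathbb{Z}\text{ - }\mathsf{RT}^{d+1}\equiv_{\mathrm{sW}}\mathsf{AHT}^d$.
   Context: For a positive integer $k$ we identify $k$ with $\{0,\dots,k-1\}$, and $[\mathbb N]^n$ denotes the set of $n$-element subsets of $\mathbb N$. A colouring $c:[\mathbb N]^n\to k$ is $\mathbb Z$-invariant if $c(\{x_1,\dots,x_n\})=c(\{x_1+z,\dots,x_n+z\})$ for all $\{x_1,\dots,x_n\}\in[\mathbb N]^n$ and all $z\in\mathbb N$. $\mathbb{Z}\text{ - }\mathsf{RT}^n$ is the problem whose instances are $\mathbb Z$-invariant colourings $c:[\mathbb N]^n\to k$ (any finite $k$) and whose solutions are infinite $X\subseteq\mathbb N$ with $[X]^n$ $c$-monochromatic. For a sequence $\vec x=\langle x_n:n\in\mathbb N\rangle$ of natural numbers and $d\geq1$, let $\mathrm{AFS}^d(\vec x)=\{(\sum_{k=k_0}^{k_1}x_k,\sum_{k=k_1+1}^{k_2}x_k,\dots,\sum_{k=k_{d-1}+1}^{k_d}x_k) : k_0\leq k_1<k_2<\cdots<k_d\}\subseteq\mathbb N^d$. $\mathsf{AHT}^d$ is the problem whose instances are colourings $c:\mathbb N^d\to k$ (any finite $k$) and whose solutions are infinite sets $Y\subseteq\mathbb N$ such that, with $\vec y$ the increasing enumeration of $Y$, $\mathrm{AFS}^d(\vec y)$ is $c$-monochromatic. A problem $P$ is strongly Weihrauch reducible to $Q$ ($P\leq_{\mathrm{sW}}Q$) if there are Turing functionals $\Phi,\Psi$ such that for every instance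 $X$ of $P$, $\Phi^X$ is an instance of $Q$, and for every solution $Y$ to $\Phi^X$, $\Psi^{Y}$ is a solution to $X$; $\equiv_{\mathrm{sW}}$ means reducibility in both directions. -}

module Defs where

open import Data.Nat using (ℕ; zero; suc; _+_; _*_; _∸_; _≤_; _<_)
open import Data.Fin using (Fin; toℕ)
import Data.Fin as F
open import Data.Vec using (Vec; []; _∷_)
open import Data.Product using (Σ; _×_; _,_; ∃)
open import Relation.Binary.PropositionalEquality using (_≡_)

-- Oracle computability: partial recursive functionals with an oracle
-- (Kleene's schemes: zero, successor, projections, oracle call,
-- composition, primitive recursion, unbounded minimisation).

Oracle : Set
Oracle = ℕ → ℕ

data Code : ℕ → Set where
  zer  : ∀ {n} → Code n
  succ : Code 1
  prj  : ∀ {n} → Fin n → Code n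
  ora  : Code 1
  comp : ∀ {m n} → Code m → Vec (Code n) m → Code n
  prec : ∀ {n} → Code n → Code (suc (suc n)) → Code (suc n)
  mu   : ∀ {n} → Code (suc n) → Code n

mutual
  data Eval (X : Oracle) : ∀ {n} → Code n → Vec ℕ n → ℕ → Set where
    ev-zer  : ∀ {n} {xs : Vec ℕ n} → Eval X zer xs 0
    ev-succ : ∀ {x} → Eval X succ (x ∷ []) (suc x)
    ev-prj  : ∀ {n} {i : Fin n} {xs} → Eval X (prj i) xs (Data.Vec.lookup xs i)
    ev-ora  : ∀ {x} → Eval X ora (x ∷ []) (X x)
    ev-comp : ∀ {m n} {f : Code m} {gs : Vec (Code n) m} {xs ys v} →
              EvalAll X xs gs ys → Eval X f ys v → Eval X (comp f gs) xs v
    ev-precZ : ∀ {n} {f : Code n} {g} {xs v} →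
               Eval X f xs v → Eval X (prec f g) (0 ∷ xs) v
    ev-precS : ∀ {n} {f : Code n} {g} {k xs w v} →
               Eval X (prec f g) (k ∷ xs) w → Eval X g (k ∷ w ∷ xs) v →
               Eval X (prec f g) (suc k ∷ xs) v
    ev-mu   : ∀ {n} {f : Code (suc n)} {xs z} →
              Eval X f (z ∷ xs) 0 →
              (∀ y → y < z → Σ ℕ λ w → Eval X f (y ∷ xs) (suc w)) →
              Eval X (mu f) xs z

  data EvalAll (X : Oracle) {n : ℕ} (xs : Vec ℕ n) : ∀ {m} → Vec (Code n) m → Vec ℕ m → Set where
    []  : EvalAll X xs [] []
    _∷_ : ∀ {m} {g : Code n} {gs : Vec (Code n) m} {y ys} →
          Eval X g xs y → EvalAll X xs gs ys → EvalAll X xs (g ∷ gs) (y ∷ ys)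

TuringFunctional : Set
TuringFunctional = Code 1

Computes : Oracle → TuringFunctional → (ℕ → ℕ) → Set
Computes X Φ g = ∀ n → Eval X Φ (n ∷ []) (g n)

record Problem : Set₁ where
  field
    Inst : Oracle → Set
    Sol  : Oracle → Oracle → Set
open Problem public

_≤sW_ : Problem → Problem → Set
P ≤sW Q = Σ TuringFunctional λ Φ → Σ TuringFunctional λ Ψ →
  ∀ X → Inst P X →
    Σ Oracle λ g → Computes X Φ g × Inst Q g ×
      (∀ Y → Sol Q g Y → Σ Oracle λ h → Computes Y Ψ h × Sol P X h)

_≡sW_ : Problem → Problem → Set
P ≡sW Q = (P ≤sW Q) × (Q ≤sW P)

tri : ℕ → ℕ
tri zero    = 0
tri (suc n) = suc n + tri n

pair : ℕ → ℕ → ℕ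
pair x y = tri (x + y) + y

-- code of a d-tuple (bijective ℕ^d → ℕ for d ≥ 1)
code : (d : ℕ) → (Fin d → ℕ) → ℕ
code zero    t = 0
code (suc zero) t = t F.zero
code (suc (suc d)) t = pair (t F.zero) (code (suc d) (λ j → t (F.suc j)))

-- subsets of ℕ are named by 0/1-valued characteristic functions
IsSetName : Oracle → Set
IsSetName χ = ∀ n → χ n ≤ 1

_∈χ_ : ℕ → Oracle → Set
n ∈χ χ = χ n ≡ 1

Infinite : Oracle → Set
Infinite χ = ∀ m → Σ ℕ λ n → m ≤ n × n ∈χ χ

-- strictly increasing tuples x₀ < x₁ < … (= elements of [ℕ]^n)
StrictInc : ∀ {n} → (Fin n → ℕ) → Set
StrictInc {n} t = ∀ (i j : Fin n) → toℕ i < toℕ j → t i < t j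

-- A name X codes the colouring {x₀<…<x_{n-1}} ↦ X (code n (x₀,…,x_{n-1})).
ZRTInst : ℕ → Oracle → Set
ZRTInst n X =
  (Σ ℕ λ k → ∀ (t : Fin n → ℕ) → StrictInc t → X (code n t) < k) ×
  (∀ (t : Fin n → ℕ) → StrictInc t → ∀ z → X (code n t) ≡ X (code n (λ j → t j + z)))

ZRTSol : ℕ → Oracle → Oracle → Set
ZRTSol n X χ = IsSetName χ × Infinite χ ×
  (Σ ℕ λ col → ∀ (t : Fin n → ℕ) → StrictInc t → (∀ j → t j ∈χ χ) → X (code n t) ≡ col)

ZRT : ℕ → Problem
ZRT n = record { Inst = ZRTInst n ; Sol = ZRTSol n }

IsEnum : Oracle → (ℕ → ℕ) → Set
IsEnum χ e = (∀ i → e i < e (suc i)) × (∀ i → e i ∈χ χ) ×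
             (∀ n → n ∈χ χ → Σ ℕ λ i → e i ≡ n)

sumFrom : (ℕ → ℕ) → ℕ → ℕ → ℕ
sumFrom e a zero      = 0
sumFrom e a (suc len) = e a + sumFrom e (suc a) len

-- Σ_{k=a}^{b} e k  (used only with a ≤ b)
rangeSum : (ℕ → ℕ) → ℕ → ℕ → ℕ
rangeSum e a b = sumFrom e a (suc b ∸ a)

-- with indices ks 0 ≤ ks 1 < ks 2 < … < ks d, the j-th block (j < d)
block : (ℕ → ℕ) → (ℕ → ℕ) → ℕ → ℕ
block e ks zero    = rangeSum e (ks 0) (ks 1)
block e ks (suc j) = rangeSum e (suc (ks (suc j))) (ks (suc (suc j)))

AdmissibleIdx : ℕ → (ℕ → ℕ) → Set
AdmissibleIdx d ks = ks 0 ≤ ks 1 × (∀ i → 1 ≤ i → i < d → ks i < ks (suc i))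

-- A name X codes the colouring c : ℕ^d → k, c(t) = X (code d t).
AHTInst : ℕ → Oracle → Set
AHTInst d X = Σ ℕ λ k → ∀ (t : Fin d → ℕ) → X (code d t) < k

AHTSol : ℕ → Oracle → Oracle → Set
AHTSol d X χ = IsSetName χ × Infinite χ ×
  (Σ ℕ λ col → ∀ e → IsEnum χ e → ∀ ks → AdmissibleIdx d ks →
     X (code d (λ j → block e ks (toℕ j))) ≡ col)

AHT : ℕ → Problem
AHT d = record { Inst = AHTInst d ; Sol = AHTSol d }

{-# OPTIONS --safe #-}
module Submission where

-- A (d+1)-set x₀ < … < x_d is determined up to translation by its gap vector
-- (x₁ ∸ x₀, …, x_d ∸ x_{d-1}), and the block sums of an AFS^d pattern are exactly the gap vectors
-- of (d+1)-sets of partial sums.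
--
-- ZRT (d+1) ≤ AHT d: colour a gap vector b by the colour of {0, b₀, b₀ + b₁, …}. If Y solves AHT
-- and e enumerates Y, the gaps of any (d+1)-set of partial sums e₀ + … + e_k are block sums of e at
-- admissible indices, so by translation invariance the set of these partial sums is homogeneous.
--
-- AHT d ≤ ZRT (d+1): colour a (d+1)-set by the colour of its gap vector, which is translation
-- invariant. In a homogeneous Y choose u₀ < u₁ < … with u_{i+1} > 2 u_i. The gaps u_{i+1} ∸ u_i then
-- increase, and every block sum of them is a difference u_k′ ∸ u_k of elements of Y, so the set of
-- gaps solves AHT.
--
-- All maps are uniformly computable: colourings only decode and re-encode tuples, and the image of a
-- strictly increasing computable sequence is decided by a bounded search.

open import Defs
open import Data.Nat using (ℕ; zero; suc; _+_; _∸_; _≤_; _<_; pred; ∣_-_∣; z≤n; s≤s; s≤s⁻¹; _≟_; _≤?_; >-nonZero)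
open import Data.Nat.Properties
open import Data.Fin using (Fin; toℕ; inject₁) renaming (zero to fz; suc to fs)
open import Data.Fin.Properties using (toℕ<n; toℕ-inject₁)
open import Data.Vec using (Vec; []; _∷_)
open import Data.Product using (Σ; _×_; _,_; proj₁; proj₂)
open import Data.Sum using (_⊎_; inj₁; inj₂; [_,_]′)
open import Data.Empty using (⊥-elim)
open import Function using (_∘_; id)
open import Level using (0ℓ)
open import Relation.Binary.PropositionalEquality
open import Relation.Nullary using (¬_; yes; no)
open import Relation.Unary using (Pred; Decidable)
open ≡-Reasoning

private variable
  d n : ℕ
  X : Oracle

-- Codes and arithmetic

infixr 9 _∙_
_∙_ : Code 1 → Code n → Code n
f ∙ g = comp f (g ∷ [])

_⟨_,_⟩ : Code 2 → Code n → Code n → Code n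
f ⟨ g , h ⟩ = comp f (g ∷ h ∷ [])

π₀ : Code (suc n)
π₀ = prj fz

π₁ : Code (2 + n)
π₁ = prj (fs fz)

π₂ : Code (3 + n)
π₂ = prj (fs (fs fz))

one : Code n
one = succ ∙ zer

Computes₂ : Oracle → Code 2 → (ℕ → ℕ → ℕ) → Set
Computes₂ X c f = ∀ a b → Eval X c (a ∷ b ∷ []) (f a b)

ev-∙ : ∀ {f : Code 1} {g : Code n} {xs a v} →
       Eval X g xs a → Eval X f (a ∷ []) v → Eval X (f ∙ g) xs v
ev-∙ g↓ f↓ = ev-comp (g↓ ∷ []) f↓

ev-⟨,⟩ : ∀ {f : Code 2} {g h : Code n} {xs a b v} →
         Eval X g xs a → Eval X h xs b → Eval X f (a ∷ b ∷ []) v → Eval X (f ⟨ g , h ⟩) xs v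
ev-⟨,⟩ g↓ h↓ f↓ = ev-comp (g↓ ∷ h↓ ∷ []) f↓

ev-one : ∀ {xs : Vec ℕ n} → Eval X one xs 1
ev-one = ev-∙ ev-zer ev-succ

id-computes : Computes X π₀ id
id-computes _ = ev-prj

suc-computes : Computes X succ suc
suc-computes _ = ev-succ

one-computes : Computes X one (λ _ → 1)
one-computes _ = ev-one

ora-computes : Computes X ora X
ora-computes _ = ev-ora

∙-computes : ∀ {f g F G} → Computes X f F → Computes X g G → Computes X (f ∙ g) (F ∘ G)
∙-computes f↓ g↓ n = ev-∙ (g↓ n) (f↓ _)

⟨,⟩-computes : ∀ {f g h F G H} → Computes₂ X f F → Computes X g G → Computes X h H →
               Computes X (f ⟨ g , h ⟩) (λ n → F (G n) (H n))
⟨,⟩-computes f↓ g↓ h↓ n = ev-⟨,⟩ (g↓ n) (h↓ n) (f↓ _ _)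

addᶜ : Code 2
addᶜ = prec π₀ (succ ∙ π₁)

add-computes : Computes₂ X addᶜ _+_
add-computes zero    b = ev-precZ ev-prj
add-computes (suc a) b = ev-precS (add-computes a b) (ev-∙ ev-prj ev-succ)

predᶜ : Code 1
predᶜ = prec zer π₀

pred-computes : Computes X predᶜ pred
pred-computes zero    = ev-precZ ev-zer
pred-computes (suc a) = ev-precS (pred-computes a) ev-prj

flippedMonusᶜ : Code 2
flippedMonusᶜ = prec π₀ (predᶜ ∙ π₁)

flippedMonus-computes : Computes₂ X flippedMonusᶜ (λ b a → a ∸ b)
flippedMonus-computes zero    a = ev-precZ ev-prj
flippedMonus-computes (suc b) a =
  subst (Eval _ flippedMonusᶜ _) (pred[m∸n]≡m∸[1+n] a b)
    (ev-precS (flippedMonus-computes b a) (ev-∙ ev-prj (pred-computes (a ∸ b))))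

monusᶜ : Code 2
monusᶜ = flippedMonusᶜ ⟨ π₁ , π₀ ⟩

monus-computes : Computes₂ X monusᶜ _∸_
monus-computes a b = ev-⟨,⟩ ev-prj ev-prj (flippedMonus-computes b a)

∣m-n∣≡[m∸n]+[n∸m] : ∀ m n → ∣ m - n ∣ ≡ (m ∸ n) + (n ∸ m)
∣m-n∣≡[m∸n]+[n∸m] zero    zero    = refl
∣m-n∣≡[m∸n]+[n∸m] zero    (suc n) = refl
∣m-n∣≡[m∸n]+[n∸m] (suc m) zero    = sym (+-identityʳ (suc m))
∣m-n∣≡[m∸n]+[n∸m] (suc m) (suc n) = ∣m-n∣≡[m∸n]+[n∸m] m n

distᶜ : Code 2
distᶜ = addᶜ ⟨ monusᶜ , monusᶜ ⟨ π₁ , π₀ ⟩ ⟩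

dist-computes : Computes₂ X distᶜ ∣_-_∣
dist-computes a b =
  subst (Eval _ distᶜ _) (sym (∣m-n∣≡[m∸n]+[n∸m] a b))
    (ev-⟨,⟩ (monus-computes a b) (ev-⟨,⟩ ev-prj ev-prj (monus-computes b a)) (add-computes _ _))

triᶜ : Code 1
triᶜ = prec zer (addᶜ ⟨ succ ∙ π₀ , π₁ ⟩)

tri-computes : Computes X triᶜ tri
tri-computes zero    = ev-precZ ev-zer
tri-computes (suc a) =
  ev-precS (tri-computes a) (ev-⟨,⟩ (ev-∙ ev-prj ev-succ) ev-prj (add-computes (suc a) (tri a)))

pairᶜ : Code 2
pairᶜ = addᶜ ⟨ triᶜ ∙ addᶜ , π₁ ⟩

pair-computes : Computes₂ X pairᶜ pair
pair-computes a b =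
  ev-⟨,⟩ (ev-∙ (add-computes a b) (tri-computes (a + b))) ev-prj (add-computes _ _)

-- Minimisation and unpairing

Least : Pred ℕ 0ℓ → ℕ → Set
Least P z = P z × (∀ y → y < z → ¬ P y)

Least-unique : ∀ {P z z′} → Least P z → Least P z′ → z ≡ z′
Least-unique (Pz , below) (Pz′ , below′) =
  ≤-antisym (≮⇒≥ λ z′<z → below _ z′<z Pz′) (≮⇒≥ λ z<z′ → below′ _ z<z′ Pz)

least : ∀ {P} → Decidable P → ∀ {z₀} → P z₀ → Σ ℕ (Least P)
least {P} P? {z₀} Pz₀ = [ id , (λ none → ⊥-elim (none z₀ ≤-refl Pz₀)) ]′ (search (suc z₀))
  where
  search : ∀ n → Σ ℕ (Least P) ⊎ (∀ y → y < n → ¬ P y)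
  search zero = inj₂ (λ _ ())
  search (suc n) with search n | P? n
  ... | inj₁ found | _      = inj₁ found
  ... | inj₂ none  | yes Pn = inj₁ (n , Pn , none)
  ... | inj₂ none  | no ¬Pn = inj₂ λ y y<1+n →
    [ none y , (λ { refl → ¬Pn }) ]′ (m≤n⇒m<n∨m≡n (s≤s⁻¹ y<1+n))

ev-mu-least : ∀ {f : Code (suc n)} {xs} (F : ℕ → ℕ) → (∀ y → Eval X f (y ∷ xs) (F y)) →
              ∀ {z} → Least (λ y → F y ≡ 0) z → Eval X (mu f) xs z
ev-mu-least {X = X} {f = f} {xs} F F↓ (Fz≡0 , below) =
  ev-mu (subst (Eval X f _) Fz≡0 (F↓ _)) (λ y y<z → positive y (below y y<z))
  where
  positive : ∀ y → F y ≢ 0 → Σ ℕ λ w → Eval X f (y ∷ xs) (suc w)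
  positive y Fy≢0 with F y | F↓ y
  ... | zero  | _   = ⊥-elim (Fy≢0 refl)
  ... | suc w | F↓y = w , F↓y

-- The diagonal of n is the least z with n < tri (suc z), phrased as a vanishing monus for μ.
diagonal-least : ∀ n → Σ ℕ (Least (λ z → suc n ∸ tri (suc z) ≡ 0))
diagonal-least n = least (λ z → suc n ∸ tri (suc z) ≟ 0) {n} (m≤n⇒m∸n≡0 (m≤m+n (suc n) (tri n)))

diagonal : ℕ → ℕ
diagonal n = proj₁ (diagonal-least n)

tri-mono-≤ : ∀ {a b} → a ≤ b → tri a ≤ tri b
tri-mono-≤ {zero}          _         = z≤n
tri-mono-≤ {suc a} {suc b} (s≤s a≤b) = +-mono-≤ (s≤s a≤b) (tri-mono-≤ a≤b)

diagonal-pair : ∀ x y → diagonal (pair x y) ≡ x + y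
diagonal-pair x y = Least-unique (proj₂ (diagonal-least (pair x y))) (on-diagonal , below-diagonal)
  where
  on-diagonal : suc (pair x y) ∸ tri (suc (x + y)) ≡ 0
  on-diagonal = m≤n⇒m∸n≡0 (s≤s (subst (tri (x + y) + y ≤_) (+-comm (tri (x + y)) (x + y))
                  (+-monoʳ-≤ (tri (x + y)) (m≤n+m y x))))
  below-diagonal : ∀ z → z < x + y → suc (pair x y) ∸ tri (suc z) ≢ 0
  below-diagonal z z<x+y =
    m>n⇒m∸n≢0 (s≤s (≤-trans (tri-mono-≤ z<x+y) (m≤m+n (tri (x + y)) y)))

unpair₂ : ℕ → ℕ
unpair₂ n = n ∸ tri (diagonal n)

unpair₁ : ℕ → ℕ
unpair₁ n = diagonal n ∸ unpair₂ n

unpair₂-pair : ∀ x y → unpair₂ (pair x y) ≡ y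
unpair₂-pair x y rewrite diagonal-pair x y = m+n∸m≡n (tri (x + y)) y

unpair₁-pair : ∀ x y → unpair₁ (pair x y) ≡ x
unpair₁-pair x y rewrite unpair₂-pair x y | diagonal-pair x y = m+n∸n≡m x y

diagonalᶜ : Code 1
diagonalᶜ = mu (monusᶜ ⟨ succ ∙ π₁ , triᶜ ∙ succ ∙ π₀ ⟩)

diagonal-computes : Computes X diagonalᶜ diagonal
diagonal-computes n = ev-mu-least (λ z → suc n ∸ tri (suc z))
  (λ z → ev-⟨,⟩ (ev-∙ ev-prj ev-succ) (ev-∙ (ev-∙ ev-prj ev-succ) (tri-computes (suc z)))
                (monus-computes _ _))
  (proj₂ (diagonal-least n))

unpair₂ᶜ : Code 1
unpair₂ᶜ = monusᶜ ⟨ π₀ , triᶜ ∙ diagonalᶜ ⟩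

unpair₂-computes : Computes X unpair₂ᶜ unpair₂
unpair₂-computes = ⟨,⟩-computes monus-computes id-computes (∙-computes tri-computes diagonal-computes)

unpair₁ᶜ : Code 1
unpair₁ᶜ = monusᶜ ⟨ diagonalᶜ , unpair₂ᶜ ⟩

unpair₁-computes : Computes X unpair₁ᶜ unpair₁
unpair₁-computes = ⟨,⟩-computes monus-computes diagonal-computes unpair₂-computes

-- Tuples

code-cong : ∀ d {t t′ : Fin d → ℕ} → (∀ j → t j ≡ t′ j) → code d t ≡ code d t′
code-cong zero          _    = refl
code-cong (suc zero)    t≗t′ = t≗t′ fz
code-cong (suc (suc d)) t≗t′ = cong₂ pair (t≗t′ fz) (code-cong (suc d) (t≗t′ ∘ fs))

decode : (d : ℕ) → ℕ → Fin d → ℕ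
decode (suc zero)    n fz     = n
decode (suc (suc d)) n fz     = unpair₁ n
decode (suc (suc d)) n (fs j) = decode (suc d) (unpair₂ n) j

decode-code : ∀ d (t : Fin d → ℕ) j → decode d (code d t) j ≡ t j
decode-code (suc zero)    t fz     = refl
decode-code (suc (suc d)) t fz     = unpair₁-pair (t fz) _
decode-code (suc (suc d)) t (fs j) rewrite unpair₂-pair (t fz) (code (suc d) (t ∘ fs)) =
  decode-code (suc d) (t ∘ fs) j

decodeᶜ : (d : ℕ) → Fin d → Code 1
decodeᶜ (suc zero)    fz     = π₀
decodeᶜ (suc (suc d)) fz     = unpair₁ᶜ
decodeᶜ (suc (suc d)) (fs j) = decodeᶜ (suc d) j ∙ unpair₂ᶜ

decode-computes : ∀ d j → Computes X (decodeᶜ d j) (λ n → decode d n j)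
decode-computes (suc zero)    fz     = id-computes
decode-computes (suc (suc d)) fz     = unpair₁-computes
decode-computes (suc (suc d)) (fs j) = ∙-computes (decode-computes (suc d) j) unpair₂-computes

encodeᶜ : (d : ℕ) → (Fin d → Code 1) → Code 1
encodeᶜ zero          cs = zer
encodeᶜ (suc zero)    cs = cs fz
encodeᶜ (suc (suc d)) cs = pairᶜ ⟨ cs fz , encodeᶜ (suc d) (cs ∘ fs) ⟩

encode-computes : ∀ d {cs} (f : ℕ → Fin d → ℕ) → (∀ j → Computes X (cs j) (λ n → f n j)) →
                  Computes X (encodeᶜ d cs) (λ n → code d (f n))
encode-computes zero          f cs↓ n = ev-zer
encode-computes (suc zero)    f cs↓   = cs↓ fz
encode-computes (suc (suc d)) f cs↓   =
  ⟨,⟩-computes pair-computes (cs↓ fz) (encode-computes (suc d) (λ n → f n ∘ fs) (cs↓ ∘ fs))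

differences : (Fin (suc d) → ℕ) → Fin d → ℕ
differences t j = t (fs j) ∸ t (inject₁ j)

differencesᶜ : (Fin (suc d) → Code 1) → Fin d → Code 1
differencesᶜ cs j = monusᶜ ⟨ cs (fs j) , cs (inject₁ j) ⟩

differences-computes : ∀ {cs} (t : ℕ → Fin (suc d) → ℕ) → (∀ i → Computes X (cs i) (λ n → t n i)) →
                       ∀ j → Computes X (differencesᶜ cs j) (λ n → differences (t n) j)
differences-computes t cs↓ j = ⟨,⟩-computes monus-computes (cs↓ (fs j)) (cs↓ (inject₁ j))

differences-cong : ∀ {t t′ : Fin (suc d) → ℕ} → (∀ i → t i ≡ t′ i) →
                   ∀ j → differences t j ≡ differences t′ j
differences-cong t≗t′ j = cong₂ _∸_ (t≗t′ (fs j)) (t≗t′ (inject₁ j))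

prefixSum : (Fin d → ℕ) → Fin (suc d) → ℕ
prefixSum         b fz     = 0
prefixSum {suc d} b (fs i) = b fz + prefixSum (b ∘ fs) i

prefixSumᶜ : (Fin d → Code 1) → Fin (suc d) → Code 1
prefixSumᶜ         cs fz     = zer
prefixSumᶜ {suc d} cs (fs i) = addᶜ ⟨ cs fz , prefixSumᶜ (cs ∘ fs) i ⟩

prefixSum-computes : ∀ {cs} (b : ℕ → Fin d → ℕ) → (∀ j → Computes X (cs j) (λ n → b n j)) →
                     ∀ i → Computes X (prefixSumᶜ cs i) (λ n → prefixSum (b n) i)
prefixSum-computes         b cs↓ fz     n = ev-zer
prefixSum-computes {suc d} b cs↓ (fs i)   =
  ⟨,⟩-computes add-computes (cs↓ fz) (prefixSum-computes (λ n → b n ∘ fs) (cs↓ ∘ fs) i)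

prefixSum-cong : ∀ {b b′ : Fin d → ℕ} → (∀ j → b j ≡ b′ j) → ∀ i → prefixSum b i ≡ prefixSum b′ i
prefixSum-cong         b≗b′ fz     = refl
prefixSum-cong {suc d} b≗b′ (fs i) = cong₂ _+_ (b≗b′ fz) (prefixSum-cong (b≗b′ ∘ fs) i)

[n∸m]+[o∸n]≡o∸m : ∀ {m n o} → m ≤ n → n ≤ o → (n ∸ m) + (o ∸ n) ≡ o ∸ m
[n∸m]+[o∸n]≡o∸m {m} {n} {o} m≤n n≤o = begin
  (n ∸ m) + (o ∸ n) ≡⟨ +-comm (n ∸ m) (o ∸ n) ⟩
  (o ∸ n) + (n ∸ m) ≡⟨ sym (+-∸-assoc (o ∸ n) m≤n) ⟩
  (o ∸ n) + n ∸ m   ≡⟨ cong (_∸ m) (m∸n+n≡m n≤o) ⟩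
  o ∸ m             ∎

[m+o]∸[n+o]≡m∸n : ∀ m n o → (m + o) ∸ (n + o) ≡ m ∸ n
[m+o]∸[n+o]≡m∸n m n o = trans (cong₂ _∸_ (+-comm m o) (+-comm n o)) ([m+n]∸[m+o]≡n∸o o m n)

StrictInc-head : ∀ {t : Fin (suc d) → ℕ} → StrictInc t → ∀ i → t fz ≤ t i
StrictInc-head t↑ fz     = ≤-refl
StrictInc-head t↑ (fs i) = <⇒≤ (t↑ fz (fs i) (s≤s z≤n))

differences-positive : ∀ {t : Fin (suc d) → ℕ} → StrictInc t → ∀ j → 0 < differences t j
differences-positive t↑ j =
  m<n⇒0<n∸m (t↑ (inject₁ j) (fs j) (s≤s (≤-reflexive (toℕ-inject₁ j))))

prefixSum-differences : ∀ {t : Fin (suc d) → ℕ} → StrictInc t →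
                        ∀ i → prefixSum (differences t) i ≡ t i ∸ t fz
prefixSum-differences {t = t}     t↑ fz     = sym (n∸n≡0 (t fz))
prefixSum-differences {suc d} {t} t↑ (fs i) = begin
  (t (fs fz) ∸ t fz) + prefixSum (differences (t ∘ fs)) i
    ≡⟨ cong (_ +_) (prefixSum-differences tail↑ i) ⟩
  (t (fs fz) ∸ t fz) + (t (fs i) ∸ t (fs fz))
    ≡⟨ [n∸m]+[o∸n]≡o∸m (StrictInc-head t↑ (fs fz)) (StrictInc-head tail↑ i) ⟩
  t (fs i) ∸ t fz
    ∎
  where
  tail↑ : StrictInc (t ∘ fs)
  tail↑ i j i<j = t↑ (fs i) (fs j) (s≤s i<j)

prefixSum-StrictInc : ∀ {b : Fin d → ℕ} → (∀ j → 0 < b j) → StrictInc (prefixSum b)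
prefixSum-StrictInc {suc d} b>0 fz     (fs j) _   = <-≤-trans (b>0 fz) (m≤m+n _ _)
prefixSum-StrictInc {suc d} b>0 (fs i) (fs j) i<j =
  +-monoʳ-< _ (prefixSum-StrictInc (b>0 ∘ fs) i j (s≤s⁻¹ i<j))

prefixSum-positive-differences : ∀ {t : Fin (suc d) → ℕ} → StrictInc t → ∀ i →
                                 prefixSum (λ j → suc (pred (differences t j))) i ≡ t i ∸ t fz
prefixSum-positive-differences t↑ i = trans
  (prefixSum-cong (λ j → suc-pred _ {{>-nonZero (differences-positive t↑ j)}}) i)
  (prefixSum-differences t↑ i)

-- Strictly increasing sequences and their images

StrictlyIncreasing : (ℕ → ℕ) → Set
StrictlyIncreasing f = ∀ i → f i < f (suc i)

increasingUpTo⇒< : ∀ (f : ℕ → ℕ) N → (∀ m → m < N → f m < f (suc m)) →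
                   ∀ {i j} → i < j → j ≤ N → f i < f j
increasingUpTo⇒< f N step {i} {suc j} i<1+j 1+j≤N with m≤n⇒m<n∨m≡n (s≤s⁻¹ i<1+j)
... | inj₁ i<j  = <-trans (increasingUpTo⇒< f N step i<j (<⇒≤ 1+j≤N)) (step j 1+j≤N)
... | inj₂ refl = step i 1+j≤N

strictlyIncreasing⇒< : ∀ {f} → StrictlyIncreasing f → ∀ {i j} → i < j → f i < f j
strictlyIncreasing⇒< {f} f↑ {j = j} i<j = increasingUpTo⇒< f j (λ m _ → f↑ m) i<j ≤-refl

strictlyIncreasing⇒≤ : ∀ {f} → StrictlyIncreasing f → ∀ {i j} → i ≤ j → f i ≤ f j
strictlyIncreasing⇒≤ f↑ i≤j with m≤n⇒m<n∨m≡n i≤j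
... | inj₁ i<j  = <⇒≤ (strictlyIncreasing⇒< f↑ i<j)
... | inj₂ refl = ≤-refl

strictlyIncreasing⇒≥id : ∀ {f} → StrictlyIncreasing f → ∀ i → i ≤ f i
strictlyIncreasing⇒≥id f↑ zero    = z≤n
strictlyIncreasing⇒≥id f↑ (suc i) = ≤-<-trans (strictlyIncreasing⇒≥id f↑ i) (f↑ i)

strictlyIncreasing-reflects-< : ∀ {f} → StrictlyIncreasing f → ∀ {i j} → f i < f j → i < j
strictlyIncreasing-reflects-< f↑ fi<fj = ≰⇒> λ j≤i → <⇒≱ fi<fj (strictlyIncreasing⇒≤ f↑ j≤i)

increasingUpTo⇒StrictInc : ∀ (f : ℕ → ℕ) d → (∀ m → m < d → f m < f (suc m)) →
                            StrictInc (λ (i : Fin (suc d)) → f (toℕ i))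
increasingUpTo⇒StrictInc f d step i j i<j = increasingUpTo⇒< f d step i<j (s≤s⁻¹ (toℕ<n j))

clamp : (n : ℕ) → ℕ → Fin (suc n)
clamp zero    _       = fz
clamp (suc n) zero    = fz
clamp (suc n) (suc m) = fs (clamp n m)

clamp-toℕ : ∀ n (i : Fin (suc n)) → clamp n (toℕ i) ≡ i
clamp-toℕ zero    fz     = refl
clamp-toℕ (suc n) fz     = refl
clamp-toℕ (suc n) (fs i) = cong fs (clamp-toℕ n i)

toℕ-clamp : ∀ n {m} → m ≤ n → toℕ (clamp n m) ≡ m
toℕ-clamp zero    z≤n               = refl
toℕ-clamp (suc n) {zero}  _         = refl
toℕ-clamp (suc n) {suc m} (s≤s m≤n) = cong suc (toℕ-clamp n m≤n)

covered⇒≤ : ∀ {e f} → StrictlyIncreasing e → StrictlyIncreasing f →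
            (∀ i → Σ ℕ λ j → e j ≡ f i) → ∀ i → e i ≤ f i
covered⇒≤ {e} {f} e↑ f↑ covers i with covers i
... | j , ej≡fi = subst (e i ≤_) ej≡fi (strictlyIncreasing⇒≤ e↑ (i≤j i ej≡fi))
  where
  i≤j : ∀ i {j} → e j ≡ f i → i ≤ j
  i≤j zero    _     = z≤n
  i≤j (suc i) ej≡fi = strictlyIncreasing-reflects-< e↑
    (≤-<-trans (covered⇒≤ e↑ f↑ covers i) (subst (f i <_) (sym ej≡fi) (f↑ i)))

IsEnum-unique : ∀ {χ e f} → IsEnum χ e → IsEnum χ f → ∀ i → e i ≡ f i
IsEnum-unique {e = e} {f} (e↑ , e∈ , e-onto) (f↑ , f∈ , f-onto) i =
  ≤-antisym (covered⇒≤ e↑ f↑ (λ i → e-onto (f i) (f∈ i)) i)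
            (covered⇒≤ f↑ e↑ (λ i → f-onto (e i) (e∈ i)) i)

count : (ℕ → ℕ) → ℕ → ℕ → ℕ
count F zero    n = 0
count F (suc k) n = count F k n + (1 ∸ ∣ F k - n ∣)

-- Only indices i ≤ n are searched, so this names the image of F only when F i ≥ i.
rangeχ : (ℕ → ℕ) → Oracle
rangeχ F n = 1 ∸ (1 ∸ count F (suc n) n)

count-pos : ∀ F {k n i} → i < k → F i ≡ n → 0 < count F k n
count-pos F {suc k} {i = i} i<1+k refl with m≤n⇒m<n∨m≡n (s≤s⁻¹ i<1+k)
... | inj₁ i<k  = <-≤-trans (count-pos F i<k refl) (m≤m+n _ _)
... | inj₂ refl =
  <-≤-trans (subst (λ x → 0 < 1 ∸ x) (sym (∣n-n∣≡0 (F i))) (s≤s z≤n)) (m≤n+m _ _)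

count-pos⇒∃ : ∀ F k n → 0 < count F k n → Σ ℕ λ i → F i ≡ n
count-pos⇒∃ F (suc k) n pos with ∣ F k - n ∣ in eq
... | zero  = k , ∣m-n∣≡0⇒m≡n eq
... | suc w = count-pos⇒∃ F k n
  (subst (0 <_) (trans (cong (count F k n +_) (0∸n≡0 w)) (+-identityʳ _)) pos)

rangeχ-isSetName : ∀ F → IsSetName (rangeχ F)
rangeχ-isSetName F n = m∸n≤m 1 (1 ∸ count F (suc n) n)

rangeχ-sound : ∀ F {n} → n ∈χ rangeχ F → Σ ℕ λ i → F i ≡ n
rangeχ-sound F {n} n∈ = count-pos⇒∃ F (suc n) n
  (n≢0⇒n>0 λ count≡0 → 0≢1+n (trans (sym (cong (λ c → 1 ∸ (1 ∸ c)) count≡0)) n∈))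

rangeχ-complete : ∀ F {i} → i ≤ F i → F i ∈χ rangeχ F
rangeχ-complete F {i} i≤Fi with count F (suc (F i)) (F i) | count-pos F (s≤s i≤Fi) refl
... | suc c | _ = cong (1 ∸_) (0∸n≡0 c)

rangeχ-IsEnum : ∀ {F} → StrictlyIncreasing F → IsEnum (rangeχ F) F
rangeχ-IsEnum {F} F↑ =
  F↑ , (λ i → rangeχ-complete F (strictlyIncreasing⇒≥id F↑ i)) , λ _ → rangeχ-sound F

rangeχ-infinite : ∀ {F} → StrictlyIncreasing F → Infinite (rangeχ F)
rangeχ-infinite {F} F↑ m =
  F m , strictlyIncreasing⇒≥id F↑ m , rangeχ-complete F (strictlyIncreasing⇒≥id F↑ m)

countᶜ : Code 1 → Code 2
countᶜ c = prec zer (addᶜ ⟨ π₁ , monusᶜ ⟨ one , distᶜ ⟨ c ∙ π₀ , π₂ ⟩ ⟩ ⟩)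

count-computes : ∀ {c F} → Computes X c F → Computes₂ X (countᶜ c) (count F)
count-computes c↓ zero    n = ev-precZ ev-zer
count-computes c↓ (suc k) n = ev-precS (count-computes c↓ k n)
  (ev-⟨,⟩ ev-prj
          (ev-⟨,⟩ ev-one (ev-⟨,⟩ (ev-∙ ev-prj (c↓ k)) ev-prj (dist-computes _ _)) (monus-computes _ _))
          (add-computes _ _))

rangeχᶜ : Code 1 → Code 1
rangeχᶜ c = monusᶜ ⟨ one , monusᶜ ⟨ one , countᶜ c ⟨ succ ∙ π₀ , π₀ ⟩ ⟩ ⟩

rangeχ-computes : ∀ {c F} → Computes X c F → Computes X (rangeχᶜ c) (rangeχ F)
rangeχ-computes c↓ = ⟨,⟩-computes monus-computes one-computes
  (⟨,⟩-computes monus-computes one-computes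
    (⟨,⟩-computes (count-computes c↓) (∙-computes suc-computes id-computes) id-computes))

-- Walking through an infinite set

nextᶜ : Code 1
nextᶜ = mu (addᶜ ⟨ monusᶜ ⟨ one , ora ∙ π₀ ⟩ , monusᶜ ⟨ π₁ , π₀ ⟩ ⟩)

chainᶜ : Code 1 → Code 1
chainᶜ step = prec (nextᶜ ∙ zer) (nextᶜ ∙ step ∙ π₁)

module Next (χ : Oracle) (χ-isSetName : IsSetName χ) (χ-infinite : Infinite χ) where

  misses : ℕ → ℕ → ℕ
  misses a m = (1 ∸ χ m) + (a ∸ m)

  misses≡0 : ∀ {a m} → a ≤ m → m ∈χ χ → misses a m ≡ 0
  misses≡0 a≤m m∈ = cong₂ _+_ (cong (1 ∸_) m∈) (m≤n⇒m∸n≡0 a≤m)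

  next-least : ∀ a → Σ ℕ (Least (λ m → misses a m ≡ 0))
  next-least a with χ-infinite a
  ... | m , a≤m , m∈ = least (λ m → misses a m ≟ 0) (misses≡0 a≤m m∈)

  next : ℕ → ℕ
  next a = proj₁ (next-least a)

  next-≥ : ∀ a → a ≤ next a
  next-≥ a = m∸n≡0⇒m≤n (m+n≡0⇒n≡0 (1 ∸ χ (next a)) (proj₁ (proj₂ (next-least a))))

  next-∈ : ∀ a → next a ∈χ χ
  next-∈ a = ≤-antisym (χ-isSetName _) (m∸n≡0⇒m≤n (m+n≡0⇒m≡0 _ (proj₁ (proj₂ (next-least a)))))

  next-minimal : ∀ {a m} → a ≤ m → m ∈χ χ → next a ≤ m
  next-minimal a≤m m∈ = ≮⇒≥ λ m<next → proj₂ (proj₂ (next-least _)) _ m<next (misses≡0 a≤m m∈)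

  next-computes : Computes χ nextᶜ next
  next-computes a = ev-mu-least (misses a)
    (λ m → ev-⟨,⟩ (ev-⟨,⟩ ev-one (ev-∙ ev-prj ev-ora) (monus-computes _ _))
                  (ev-⟨,⟩ ev-prj ev-prj (monus-computes _ _)) (add-computes _ _))
    (proj₂ (next-least a))

  chain : (ℕ → ℕ) → ℕ → ℕ
  chain step zero    = next 0
  chain step (suc k) = next (step (chain step k))

  chain-∈ : ∀ step k → chain step k ∈χ χ
  chain-∈ step zero    = next-∈ 0
  chain-∈ step (suc k) = next-∈ _

  chain-computes : ∀ {c} step → Computes χ c step → Computes χ (chainᶜ c) (chain step)
  chain-computes step c↓ zero    = ev-precZ (ev-∙ ev-zer (next-computes 0))
  chain-computes step c↓ (suc k) =
    ev-precS (chain-computes step c↓ k) (ev-∙ (ev-∙ ev-prj (c↓ _)) (next-computes _))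

  enumeration : ℕ → ℕ
  enumeration = chain suc

  enumeration-increasing : StrictlyIncreasing enumeration
  enumeration-increasing i = next-≥ _

  enumeration-onto : ∀ n → n ∈χ χ → Σ ℕ λ i → enumeration i ≡ n
  enumeration-onto n n∈
    with least (λ i → n ≤? enumeration i) {n} (strictlyIncreasing⇒≥id enumeration-increasing n)
  ... | zero  , n≤e₀   , _     = zero , ≤-antisym (next-minimal z≤n n∈) n≤e₀
  ... | suc i , n≤e₁₊ᵢ , below =
    suc i , ≤-antisym (next-minimal (≰⇒> (below i ≤-refl)) n∈) n≤e₁₊ᵢ

  enumeration-IsEnum : IsEnum χ enumeration
  enumeration-IsEnum = enumeration-increasing , chain-∈ suc , enumeration-onto

  -- Each term exceeds twice the previous one, which makes the gaps increase.
  sparse : ℕ → ℕ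
  sparse = chain λ x → suc (x + x)

  gaps : ℕ → ℕ
  gaps i = sparse (suc i) ∸ sparse i

  sparse-increasing : StrictlyIncreasing sparse
  sparse-increasing i = ≤-trans (s≤s (m≤m+n _ _)) (next-≥ _)

  sparse-increments : ∀ i → sparse (suc i) ≡ sparse i + gaps i
  sparse-increments i = sym (m+[n∸m]≡n (<⇒≤ (sparse-increasing i)))

  gaps-increasing : StrictlyIncreasing gaps
  gaps-increasing i = ≤-trans (s≤s (m∸n≤m (sparse (suc i)) (sparse i)))
    (subst (_≤ gaps (suc i)) (m+n∸n≡m (suc (sparse (suc i))) (sparse (suc i)))
      (∸-monoˡ-≤ (sparse (suc i)) (next-≥ _)))

enumerationᶜ : Code 1
enumerationᶜ = chainᶜ succ

sparseᶜ : Code 1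
sparseᶜ = chainᶜ (succ ∙ addᶜ ⟨ π₀ , π₀ ⟩)

gapsᶜ : Code 1
gapsᶜ = monusᶜ ⟨ sparseᶜ ∙ succ , sparseᶜ ⟩

module _ (χ : Oracle) (χ-isSetName : IsSetName χ) (χ-infinite : Infinite χ) where
  open Next χ χ-isSetName χ-infinite

  enumeration-computes : Computes χ enumerationᶜ enumeration
  enumeration-computes = chain-computes suc suc-computes

  gaps-computes : Computes χ gapsᶜ gaps
  gaps-computes = ⟨,⟩-computes monus-computes (∙-computes sparse↓ suc-computes) sparse↓
    where
    sparse↓ : Computes χ sparseᶜ sparse
    sparse↓ = chain-computes _ λ x → ev-∙ (ev-⟨,⟩ ev-prj ev-prj (add-computes x x)) ev-succ

-- Partial sums and blocks

partialSum : (ℕ → ℕ) → ℕ → ℕ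
partialSum e zero    = 0
partialSum e (suc k) = partialSum e k + e k

partialSumᶜ : Code 1 → Code 1
partialSumᶜ c = prec zer (addᶜ ⟨ π₁ , c ∙ π₀ ⟩)

partialSum-computes : ∀ {c e} → Computes X c e → Computes X (partialSumᶜ c) (partialSum e)
partialSum-computes c↓ zero    = ev-precZ ev-zer
partialSum-computes c↓ (suc k) =
  ev-precS (partialSum-computes c↓ k) (ev-⟨,⟩ ev-prj (ev-∙ ev-prj (c↓ k)) (add-computes _ _))

partialSum-increasing : ∀ {e} → StrictlyIncreasing e → StrictlyIncreasing (partialSum e ∘ suc)
partialSum-increasing e↑ i = m<m+n _ (≤-<-trans z≤n (e↑ i))

-- block e ks j sums e over the indices from boundary ks j up to, but excluding, boundary ks (suc j).
boundary : (ℕ → ℕ) → ℕ → ℕ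
boundary ks zero    = ks 0
boundary ks (suc j) = suc (ks (suc j))

admissible⇒boundary-< : ∀ {ks} → AdmissibleIdx d ks →
                         ∀ j → j < d → boundary ks j < boundary ks (suc j)
admissible⇒boundary-< (ks₀≤ks₁ , _) zero    _   = s≤s ks₀≤ks₁
admissible⇒boundary-< (_ , ks-step) (suc j) j<d = s≤s (ks-step (suc j) (s≤s z≤n) j<d)

boundary-<⇒admissible : ∀ {ks} → 1 ≤ d → (∀ j → j < d → boundary ks j < boundary ks (suc j)) →
                        AdmissibleIdx d ks
boundary-<⇒admissible 1≤d boundary-step = s≤s⁻¹ (boundary-step 0 1≤d) , λ where
  (suc i) _ i<d → s≤s⁻¹ (boundary-step (suc i) i<d)

module _ {e : ℕ → ℕ} (S : ℕ → ℕ) (S-increments : ∀ i → S (suc i) ≡ S i + e i) where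

  sumFrom-telescopes : ∀ a len → S a + sumFrom e a len ≡ S (a + len)
  sumFrom-telescopes a zero      = trans (+-identityʳ (S a)) (cong S (sym (+-identityʳ a)))
  sumFrom-telescopes a (suc len) = begin
    S a + (e a + sumFrom e (suc a) len) ≡⟨ sym (+-assoc (S a) (e a) _) ⟩
    S a + e a + sumFrom e (suc a) len   ≡⟨ cong (_+ sumFrom e (suc a) len) (sym (S-increments a)) ⟩
    S (suc a) + sumFrom e (suc a) len   ≡⟨ sumFrom-telescopes (suc a) len ⟩
    S (suc a + len)                     ≡⟨ cong S (sym (+-suc a len)) ⟩
    S (a + suc len)                     ∎

  rangeSum-telescopes : ∀ {a b} → a ≤ suc b → rangeSum e a b ≡ S (suc b) ∸ S a
  rangeSum-telescopes {a} {b} a≤1+b = begin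
    rangeSum e a b             ≡⟨ sym (m+n∸m≡n (S a) _) ⟩
    S a + rangeSum e a b ∸ S a ≡⟨ cong (_∸ S a) (sumFrom-telescopes a (suc b ∸ a)) ⟩
    S (a + (suc b ∸ a)) ∸ S a  ≡⟨ cong (λ m → S m ∸ S a) (m+[n∸m]≡n a≤1+b) ⟩
    S (suc b) ∸ S a            ∎

  block-telescopes : ∀ ks j → boundary ks j ≤ boundary ks (suc j) →
                     block e ks j ≡ S (boundary ks (suc j)) ∸ S (boundary ks j)
  block-telescopes ks zero    = rangeSum-telescopes
  block-telescopes ks (suc j) = rangeSum-telescopes

  blocks≡differences : ∀ {ks} → AdmissibleIdx d ks → ∀ (j : Fin d) →
                       block e ks (toℕ j) ≡ differences (λ i → S (boundary ks (toℕ i))) j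
  blocks≡differences {ks = ks} adm j = begin
    block e ks (toℕ j)
      ≡⟨ block-telescopes ks (toℕ j) (<⇒≤ (admissible⇒boundary-< adm (toℕ j) (toℕ<n j))) ⟩
    S (boundary ks (suc (toℕ j))) ∸ S (boundary ks (toℕ j))
      ≡⟨ cong (λ m → S (boundary ks (suc (toℕ j))) ∸ S (boundary ks m)) (sym (toℕ-inject₁ j)) ⟩
    differences (λ i → S (boundary ks (toℕ i))) j
      ∎

tuple-boundaries : ∀ (S : ℕ → ℕ) → 1 ≤ d → StrictlyIncreasing (S ∘ suc) →
                   (t : Fin (suc d) → ℕ) → StrictInc t → (∀ i → Σ ℕ λ k → S (suc k) ≡ t i) →
                   Σ (ℕ → ℕ) λ ks → AdmissibleIdx d ks × (∀ i → S (boundary ks (toℕ i)) ≡ t i)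
tuple-boundaries {d} S 1≤d S↑ t t↑ t∈ =
  ks , boundary-<⇒admissible 1≤d boundary-step , on-boundary
  where
  I : ℕ → ℕ
  I m = proj₁ (t∈ (clamp d m))
  S-I : ∀ m → S (suc (I m)) ≡ t (clamp d m)
  S-I m = proj₂ (t∈ (clamp d m))
  ks : ℕ → ℕ
  ks zero    = suc (I 0)
  ks (suc j) = I (suc j)
  boundary-ks : ∀ m → boundary ks m ≡ suc (I m)
  boundary-ks zero    = refl
  boundary-ks (suc m) = refl
  I-step : ∀ m → m < d → I m < I (suc m)
  I-step m m<d = strictlyIncreasing-reflects-< S↑ (subst₂ _<_ (sym (S-I m)) (sym (S-I (suc m)))
    (t↑ _ _ (subst₂ _<_ (sym (toℕ-clamp d (<⇒≤ m<d))) (sym (toℕ-clamp d m<d)) (n<1+n m))))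
  boundary-step : ∀ m → m < d → boundary ks m < boundary ks (suc m)
  boundary-step m m<d = subst (_< suc (I (suc m))) (sym (boundary-ks m)) (s≤s (I-step m m<d))
  on-boundary : ∀ i → S (boundary ks (toℕ i)) ≡ t i
  on-boundary i = trans (cong S (boundary-ks (toℕ i))) (trans (S-I (toℕ i)) (cong t (clamp-toℕ d i)))

-- The two reductions

≤sW-intro : ∀ {P Q : Problem} (Φ Ψ : TuringFunctional) (G : Oracle → Oracle) →
            (∀ X → Computes X Φ (G X)) → (∀ {X} → Inst P X → Inst Q (G X)) →
            (∀ {X} → Inst P X → ∀ Y → Sol Q (G X) Y → Σ Oracle λ h → Computes Y Ψ h × Sol P X h) →
            P ≤sW Q
≤sW-intro Φ Ψ G G-computes G-inst solve =
  Φ , Ψ , λ X X-inst → G X , G-computes X , G-inst X-inst , solve X-inst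

differenceColouring : (d : ℕ) → Oracle → Oracle
differenceColouring d X n = X (code d (differences (decode (suc d) n)))

differenceColouringᶜ : ℕ → TuringFunctional
differenceColouringᶜ d = ora ∙ encodeᶜ d (differencesᶜ (decodeᶜ (suc d)))

differenceColouring-computes : ∀ d X → Computes X (differenceColouringᶜ d) (differenceColouring d X)
differenceColouring-computes d X = ∙-computes ora-computes
  (encode-computes d (differences ∘ decode (suc d))
    (differences-computes (decode (suc d)) (decode-computes (suc d))))

differenceColouring-code : ∀ d X t →
                           differenceColouring d X (code (suc d) t) ≡ X (code d (differences t))
differenceColouring-code d X t = cong X (code-cong d (differences-cong (decode-code (suc d) t)))

differenceColouring-ZRTInst : ∀ d X → AHTInst d X → ZRTInst (suc d) (differenceColouring d X)
differenceColouring-ZRTInst d X (k , bounded) = (k , λ _ _ → bounded _) , λ t _ z → begin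
  differenceColouring d X (code (suc d) t)
    ≡⟨ differenceColouring-code d X t ⟩
  X (code d (differences t))
    ≡⟨ cong X (code-cong d λ j → sym ([m+o]∸[n+o]≡m∸n (t (fs j)) (t (inject₁ j)) z)) ⟩
  X (code d (differences (λ i → t i + z)))
    ≡⟨ sym (differenceColouring-code d X _) ⟩
  differenceColouring d X (code (suc d) (λ i → t i + z))
    ∎

differenceColouring-solution : ∀ d X Y → ZRTSol (suc d) (differenceColouring d X) Y →
                               Σ Oracle λ h → Computes Y (rangeχᶜ gapsᶜ) h × AHTSol d X h
differenceColouring-solution d X Y (Y-isSetName , Y-infinite , col , homogeneous) =
  rangeχ gaps , rangeχ-computes (gaps-computes Y Y-isSetName Y-infinite) ,
  rangeχ-isSetName gaps , rangeχ-infinite gaps-increasing , col , monochromatic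
  where
  open Next Y Y-isSetName Y-infinite
  monochromatic : ∀ e → IsEnum (rangeχ gaps) e → ∀ ks → AdmissibleIdx d ks →
                  X (code d (λ j → block e ks (toℕ j))) ≡ col
  monochromatic e e-enum ks adm = begin
    X (code d (λ j → block e ks (toℕ j)))
      ≡⟨ cong X (code-cong d (blocks≡differences sparse increments adm)) ⟩
    X (code d (differences x))
      ≡⟨ sym (differenceColouring-code d X x) ⟩
    differenceColouring d X (code (suc d) x)
      ≡⟨ homogeneous x x↑ (λ i → chain-∈ _ (boundary ks (toℕ i))) ⟩
    col
      ∎
    where
    x : Fin (suc d) → ℕ
    x i = sparse (boundary ks (toℕ i))
    increments : ∀ i → sparse (suc i) ≡ sparse i + e i
    increments i = trans (sparse-increments i)
      (cong (sparse i +_) (IsEnum-unique (rangeχ-IsEnum gaps-increasing) e-enum i))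
    x↑ : StrictInc x
    x↑ = increasingUpTo⇒StrictInc (sparse ∘ boundary ks) d
           λ m m<d → strictlyIncreasing⇒< sparse-increasing (admissible⇒boundary-< adm m m<d)

AHT≤sWZRT : ∀ d → AHT d ≤sW ZRT (suc d)
AHT≤sWZRT d = ≤sW-intro (differenceColouringᶜ d) (rangeχᶜ gapsᶜ) (differenceColouring d)
  (differenceColouring-computes d) (λ {X} → differenceColouring-ZRTInst d X)
  (λ {X} _ → differenceColouring-solution d X)

translate-to-origin : ∀ d X → ZRTInst (suc d) X → ∀ {t} → StrictInc t →
                      X (code (suc d) t) ≡ X (code (suc d) (λ i → t i ∸ t fz))
translate-to-origin d X (_ , invariant) {t} t↑ = begin
  X (code (suc d) t)
    ≡⟨ cong X (code-cong (suc d) λ i → sym (m∸n+n≡m (StrictInc-head t↑ i))) ⟩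
  X (code (suc d) (λ i → (t i ∸ t fz) + t fz))
    ≡⟨ sym (invariant _ shifted↑ (t fz)) ⟩
  X (code (suc d) (λ i → t i ∸ t fz))
    ∎
  where
  shifted↑ : StrictInc (λ i → t i ∸ t fz)
  shifted↑ i j i<j = ∸-monoˡ-< (t↑ i j i<j) (StrictInc-head t↑ i)

-- suc ∘ pred fixes positive gaps and turns 0 into 1, so X is only consulted on increasing tuples.
gapColouring : (d : ℕ) → Oracle → Oracle
gapColouring d X n = X (code (suc d) (prefixSum (λ j → suc (pred (decode d n j)))))

gapColouringᶜ : ℕ → TuringFunctional
gapColouringᶜ d = ora ∙ encodeᶜ (suc d) (prefixSumᶜ (λ j → succ ∙ predᶜ ∙ decodeᶜ d j))

gapColouring-computes : ∀ d X → Computes X (gapColouringᶜ d) (gapColouring d X)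
gapColouring-computes d X = ∙-computes ora-computes
  (encode-computes (suc d) (λ n → prefixSum (λ j → suc (pred (decode d n j))))
    (prefixSum-computes (λ n j → suc (pred (decode d n j)))
      (λ j → ∙-computes suc-computes (∙-computes pred-computes (decode-computes d j)))))

gapColouring-code : ∀ d X b →
                    gapColouring d X (code d b) ≡ X (code (suc d) (prefixSum (λ j → suc (pred (b j)))))
gapColouring-code d X b =
  cong X (code-cong (suc d) (prefixSum-cong (cong (suc ∘ pred) ∘ decode-code d b)))

gapColouring-AHTInst : ∀ d X → ZRTInst (suc d) X → AHTInst d (gapColouring d X)
gapColouring-AHTInst d X ((k , bounded) , _) =
  k , λ _ → bounded _ (prefixSum-StrictInc λ _ → s≤s z≤n)

gapColouring-solution : ∀ d X → 1 ≤ d → ZRTInst (suc d) X → ∀ Y → AHTSol d (gapColouring d X) Y →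
                        Σ Oracle λ h → Computes Y (rangeχᶜ (partialSumᶜ enumerationᶜ ∙ succ)) h ×
                                       ZRTSol (suc d) X h
gapColouring-solution d X 1≤d X-inst Y (Y-isSetName , Y-infinite , col , monochromatic) =
  rangeχ (S ∘ suc) ,
  rangeχ-computes (∙-computes (partialSum-computes (enumeration-computes Y Y-isSetName Y-infinite))
                              suc-computes) ,
  rangeχ-isSetName _ , rangeχ-infinite S↑ , col , homogeneous
  where
  open Next Y Y-isSetName Y-infinite
  S : ℕ → ℕ
  S = partialSum enumeration
  S↑ : StrictlyIncreasing (S ∘ suc)
  S↑ = partialSum-increasing enumeration-increasing
  homogeneous : ∀ t → StrictInc t → (∀ i → t i ∈χ rangeχ (S ∘ suc)) → X (code (suc d) t) ≡ col
  homogeneous t t↑ t∈ with tuple-boundaries S 1≤d S↑ t t↑ (λ i → rangeχ-sound (S ∘ suc) (t∈ i))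
  ... | ks , adm , S-boundary = begin
    X (code (suc d) t)
      ≡⟨ translate-to-origin d X X-inst t↑ ⟩
    X (code (suc d) (λ i → t i ∸ t fz))
      ≡⟨ cong X (code-cong (suc d) λ i → sym (prefixSum-positive-differences t↑ i)) ⟩
    X (code (suc d) (prefixSum (λ j → suc (pred (differences t j)))))
      ≡⟨ sym (gapColouring-code d X (differences t)) ⟩
    gapColouring d X (code d (differences t))
      ≡⟨ cong (gapColouring d X) (code-cong d λ j → sym (blocks-are-differences j)) ⟩
    gapColouring d X (code d (λ j → block enumeration ks (toℕ j)))
      ≡⟨ monochromatic enumeration enumeration-IsEnum ks adm ⟩
    col
      ∎
    where
    blocks-are-differences : ∀ j → block enumeration ks (toℕ j) ≡ differences t j
    blocks-are-differences j =
      trans (blocks≡differences S (λ _ → refl) adm j) (differences-cong S-boundary j)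

ZRT≤sWAHT : ∀ d → 1 ≤ d → ZRT (suc d) ≤sW AHT d
ZRT≤sWAHT d 1≤d = ≤sW-intro (gapColouringᶜ d) (rangeχᶜ (partialSumᶜ enumerationᶜ ∙ succ))
  (gapColouring d) (gapColouring-computes d) (λ {X} → gapColouring-AHTInst d X)
  (λ {X} → gapColouring-solution d X 1≤d)

mainTheorem5 : (d : ℕ) → 1 ≤ d → ZRT (suc d) ≡sW AHT d
mainTheorem5 d 1≤d = ZRT≤sWAHT d 1≤d , AHT≤sWZRT d
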